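{- Let $n>k$ be natural numbers. There exists a simple graph $G_{n,k}$ on $n$ vertices such that $h_k(G_{n,k})=f_0(n,k)$. Consequently $f(n,k)\leqslant f_0(n,k)$.
   Context: All graphs are finite, undirected, without loops or multiple edges. For a graph $G$ and a natural number $k$, $h_k(G)$ denotes the number of unordered pairs of distinct vertices of $G$ whose degrees differ by less than $k$. For natural numbers $n>k$, $f(n,k)$ is the minimum of $h_k(G)$ over all graphs $G$ on $n$ vertices, and $$f_0(n,k):=\left(\left\lceil \tfrac{n}{k} \right\rceil - 2\right)\binom{k}{2} + \binom{k+1}{2} + \binom{n-k \left( \left\lceil\frac{n}{k} \right\rceil - 1 \right)-1}{2},$$ where $\binom{m}{2}=m(m-1)/2$ (so $\binom{0}{2}=0$). -}

module Defs where

open import Data.Nat using (ℕ; zero; suc; _+_; _*_; _∸_; _<_; _≤_; NonZero)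
open import Data.Nat.DivMod using (_/_)
open import Data.Nat.Combinatorics using (_C_)
open import Data.Bool using (Bool; true; false; T; not)
open import Data.Fin using (Fin; toℕ)
open import Data.List using (List; length; filter; allFin; concatMap; map)
open import Data.Product using (Σ; _×_; _,_; proj₁; proj₂)
open import Relation.Binary.PropositionalEquality using (_≡_)
open import Relation.Nullary.Decidable using (does)
open import Data.Nat using (_<?_; _≟_)

record SimpleGraph (n : ℕ) : Set where
  field
    adj      : Fin n → Fin n → Bool
    symm     : ∀ u v → adj u v ≡ adj v u
    irrefl   : ∀ v → adj v v ≡ false

open SimpleGraph public

degree : ∀ {n} → SimpleGraph n → Fin n → ℕ
degree {n} G v = length (filter (λ u → T? (adj G v u)) (allFin n))
  where
  open import Data.Bool.Properties using (T?)

absDiff : ℕ → ℕ → ℕ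
absDiff m n = Data.Nat.∣ m - n ∣
  where import Data.Nat

pairs : (n : ℕ) → List (Fin n × Fin n)
pairs n = filter (λ p → toℕ (proj₁ p) <? toℕ (proj₂ p))
            (concatMap (λ i → map (λ j → i , j) (allFin n)) (allFin n))

h : ∀ {n} → ℕ → SimpleGraph n → ℕ
h {n} k G = length (filter (λ p → absDiff (degree G (proj₁ p)) (degree G (proj₂ p)) <? k) (pairs n))

ceilDiv : (n k : ℕ) → .{{NonZero k}} → ℕ
ceilDiv n k = (n + (k ∸ 1)) / k

binom2 : ℕ → ℕ
binom2 m = m C 2

f₀ : (n k : ℕ) → .{{NonZero k}} → ℕ
f₀ n k = ((ceilDiv n k ∸ 2) * binom2 k) + binom2 (k + 1)
         + binom2 ((n ∸ (k * (ceilDiv n k ∸ 1))) ∸ 1)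

IsMinH : (n k m : ℕ) → Set
IsMinH n k m = Σ (SimpleGraph n) (λ G → h k G ≡ m) × (∀ (G : SimpleGraph n) → m ≤ h k G)

{-# OPTIONS --safe #-}
module Submission where

open import Defs
open import Data.Bool using (Bool; true; false; not; _∧_; if_then_else_)
open import Data.Bool.Properties using (∧-zeroʳ; ∧-identityʳ; T?)
open import Data.Nat
open import Data.Nat.DivMod using (m≡m%n+[m/n]*n; m%n<n)
open import Data.Nat.Combinatorics using (_C_; nCk+nC[k+1]≡[n+1]C[k+1]; nC1≡n)
open import Data.Nat.Properties
open import Data.Fin using (Fin; toℕ; zero; suc)
open import Data.List using (List; []; _∷_; length; filter; allFin; concatMap; map; tabulate; _++_)
open import Data.Product using (Σ; ∃-syntax; _×_; _,_; proj₁; proj₂)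
open import Level using (Level)
open import Relation.Unary using (Pred; Decidable)
open import Relation.Binary.Definitions using (tri<; tri≈; tri>)
open import Data.Nat.Solver using (module +-*-Solver)
open +-*-Solver
open import Relation.Binary.PropositionalEquality
open import Relation.Nullary using (Dec; yes; no; does; ¬_; contradiction)
open import Relation.Nullary.Decidable using (dec-true; dec-false)

-- Cut the vertices 0, …, n − 1 into p + 2 consecutive blocks, p = ⌈n/k⌉ − 2, of sizes
-- k, …, k, k + 1, k, …, k, r with the k + 1 at index ⌈p/2⌉ and r = n − k(p + 1) − 1, and join
-- distinct vertices of blocks a and b iff a + b ≥ p + 1. A vertex of block a has degree
-- weight a − [2a ≥ p + 1], where weight a is the total size of the blocks t with a + t ≥ p + 1.
-- For blocks a < b, weight b − weight a includes block p − a, of size ≥ k, and also block ⌈p/2⌉,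
-- of size k + 1, when only b has the correction term (2a ≤ p < 2b). So degrees differ by less
-- than k exactly within a block, and h_k = p·C(k,2) + C(k+1,2) + C(r,2) = f₀(n,k).

sumBelow : ℕ → (ℕ → ℕ) → ℕ
sumBelow zero    f = 0
sumBelow (suc n) f = f 0 + sumBelow n (λ j → f (suc j))

syntax sumBelow n (λ j → e) = ∑[ j < n ] e

𝟙 : Bool → ℕ
𝟙 true  = 1
𝟙 false = 0

sumBelow-cong : ∀ n {f g : ℕ → ℕ} → (∀ j → j < n → f j ≡ g j) → sumBelow n f ≡ sumBelow n g
sumBelow-cong zero    f≡g = refl
sumBelow-cong (suc n) f≡g = cong₂ _+_ (f≡g 0 z<s) (sumBelow-cong n (λ j j<n → f≡g (suc j) (s<s j<n)))

sumBelow-+ : ∀ a b f → sumBelow (a + b) f ≡ sumBelow a f + ∑[ j < b ] f (a + j)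
sumBelow-+ zero    b f = refl
sumBelow-+ (suc a) b f = trans (cong (f 0 +_) (sumBelow-+ a b (λ j → f (suc j)))) (sym (+-assoc (f 0) _ _))

sumBelow-suc : ∀ n f → sumBelow (suc n) f ≡ sumBelow n f + f n
sumBelow-suc zero    f = +-comm (f 0) 0
sumBelow-suc (suc n) f = trans (cong (f 0 +_) (sumBelow-suc n (λ j → f (suc j)))) (sym (+-assoc (f 0) _ _))

sumBelow-const : ∀ n c → ∑[ _ < n ] c ≡ n * c
sumBelow-const zero    c = refl
sumBelow-const (suc n) c = cong (c +_) (sumBelow-const n c)

sumBelow-mono : ∀ n {f g : ℕ → ℕ} → (∀ j → j < n → f j ≤ g j) → sumBelow n f ≤ sumBelow n g
sumBelow-mono zero    f≤g = z≤n
sumBelow-mono (suc n) f≤g = +-mono-≤ (f≤g 0 z<s) (sumBelow-mono n (λ j j<n → f≤g (suc j) (s<s j<n)))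

sumBelow-mono-gap : ∀ n {f g : ℕ → ℕ} d t → t < n → (∀ j → j < n → f j ≤ g j) → f t + d ≤ g t →
                    sumBelow n f + d ≤ sumBelow n g
sumBelow-mono-gap (suc n) {f} {g} d zero _ f≤g gap = begin
  f 0 + sumBelow n _ + d   ≡⟨ +-assoc (f 0) _ d ⟩
  f 0 + (sumBelow n _ + d) ≡⟨ cong (f 0 +_) (+-comm (sumBelow n _) d) ⟩
  f 0 + (d + sumBelow n _) ≡⟨ +-assoc (f 0) d _ ⟨
  f 0 + d + sumBelow n _   ≤⟨ +-mono-≤ gap (sumBelow-mono n (λ j j<n → f≤g (suc j) (s<s j<n))) ⟩
  g 0 + sumBelow n _       ∎
  where open ≤-Reasoning
sumBelow-mono-gap (suc n) {f} {g} d (suc t) (s<s t<n) f≤g gap = begin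
  f 0 + sumBelow n _ + d   ≡⟨ +-assoc (f 0) _ d ⟩
  f 0 + (sumBelow n _ + d) ≤⟨ +-mono-≤ (f≤g 0 z<s)
                                (sumBelow-mono-gap n d t t<n (λ j j<n → f≤g (suc j) (s<s j<n)) gap) ⟩
  g 0 + sumBelow n _       ∎
  where open ≤-Reasoning

sumBelow-𝟙-const : ∀ n b → ∑[ _ < n ] 𝟙 b ≡ (if b then n else 0)
sumBelow-𝟙-const n true  = trans (sumBelow-const n 1) (*-identityʳ n)
sumBelow-𝟙-const n false = trans (sumBelow-const n 0) (*-zeroʳ n)

sumBelow-if-≟ : ∀ p c u v → c ≤ p → ∑[ a < suc p ] (if does (a ≟ c) then u else v) ≡ p * v + u
sumBelow-if-≟ zero    zero    u v _         = +-identityʳ u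
sumBelow-if-≟ (suc p) zero    u v _         = trans (cong (u +_) (sumBelow-const (suc p) v)) (+-comm u _)
sumBelow-if-≟ (suc p) (suc c) u v (s≤s c≤p) =
  trans (cong (v +_) (sumBelow-if-≟ p c u v c≤p)) (sym (+-assoc v (p * v) u))

count-< : ∀ n i → ∑[ j < n ] 𝟙 (does (i <? j)) ≡ n ∸ suc i
count-< zero    i       = refl
count-< (suc n) zero    = trans (sumBelow-const n 1) (*-identityʳ n)
count-< (suc n) (suc i) = count-< n i

sumBelow-∸ : ∀ n → ∑[ i < n ] (n ∸ suc i) ≡ n C 2
sumBelow-∸ zero    = refl
sumBelow-∸ (suc n) = begin
  n + ∑[ i < n ] (n ∸ suc i) ≡⟨ cong₂ _+_ (sym (nC1≡n n)) (sumBelow-∸ n) ⟩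
  n C 1 + n C 2              ≡⟨ nCk+nC[k+1]≡[n+1]C[k+1] n 1 ⟩
  suc n C 2                  ∎
  where open ≡-Reasoning

does-≟-sym : ∀ a b → does (a ≟ b) ≡ does (b ≟ a)
does-≟-sym zero    zero    = refl
does-≟-sym zero    (suc b) = refl
does-≟-sym (suc a) zero    = refl
does-≟-sym (suc a) (suc b) = does-≟-sym a b

does-≟-refl : ∀ a → does (a ≟ a) ≡ true
does-≟-refl a = dec-true (a ≟ a) refl

+-cancelˡ-<? : ∀ s i j → does (s + i <? s + j) ≡ does (i <? j)
+-cancelˡ-<? zero    i j = refl
+-cancelˡ-<? (suc s) i j = +-cancelˡ-<? s i j

count-≢-+-self : ∀ n i (p : ℕ → Bool) → i < n →
          ∑[ j < n ] 𝟙 (not (does (i ≟ j)) ∧ p j) + 𝟙 (p i) ≡ ∑[ j < n ] 𝟙 (p j)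
count-≢-+-self (suc n) zero    p _         = +-comm (∑[ j < n ] 𝟙 (p (suc j))) (𝟙 (p 0))
count-≢-+-self (suc n) (suc i) p (s<s i<n) = trans (+-assoc (𝟙 (p 0)) _ _)
  (cong (𝟙 (p 0) +_) (count-≢-+-self n i (λ j → p (suc j)) i<n))

sumOver : {X : Set} → (X → ℕ) → List X → ℕ
sumOver F []       = 0
sumOver F (x ∷ xs) = F x + sumOver F xs

sumOver-cong : {X : Set} {F G : X → ℕ} (xs : List X) → (∀ x → F x ≡ G x) → sumOver F xs ≡ sumOver G xs
sumOver-cong []       F≡G = refl
sumOver-cong (x ∷ xs) F≡G = cong₂ _+_ (F≡G x) (sumOver-cong xs F≡G)

length-filter≡sumOver : {X : Set} {ℓ : Level} {P : Pred X ℓ} (P? : Decidable P) (xs : List X) →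
                        length (filter P? xs) ≡ sumOver (λ x → 𝟙 (does (P? x))) xs
length-filter≡sumOver P? []       = refl
length-filter≡sumOver P? (x ∷ xs) with does (P? x)
... | true  = cong suc (length-filter≡sumOver P? xs)
... | false = length-filter≡sumOver P? xs

sumOver-filter : {X : Set} {ℓ : Level} {P : Pred X ℓ} (P? : Decidable P) (b : X → Bool) (xs : List X) →
                 sumOver (λ x → 𝟙 (b x)) (filter P? xs) ≡ sumOver (λ x → 𝟙 (does (P? x) ∧ b x)) xs
sumOver-filter P? b []       = refl
sumOver-filter P? b (x ∷ xs) with does (P? x)
... | true  = cong (𝟙 (b x) +_) (sumOver-filter P? b xs)
... | false = sumOver-filter P? b xs

sumOver-++ : {X : Set} (F : X → ℕ) (xs ys : List X) → sumOver F (xs ++ ys) ≡ sumOver F xs + sumOver F ys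
sumOver-++ F []       ys = refl
sumOver-++ F (x ∷ xs) ys = trans (cong (F x +_) (sumOver-++ F xs ys)) (sym (+-assoc (F x) _ _))

sumOver-concatMap : {X Y : Set} (F : Y → ℕ) (f : X → List Y) (xs : List X) →
                    sumOver F (concatMap f xs) ≡ sumOver (λ x → sumOver F (f x)) xs
sumOver-concatMap F f []       = refl
sumOver-concatMap F f (x ∷ xs) =
  trans (sumOver-++ F (f x) (concatMap f xs)) (cong (sumOver F (f x) +_) (sumOver-concatMap F f xs))

sumOver-map : {X Y : Set} (F : Y → ℕ) (g : X → Y) (xs : List X) →
              sumOver F (map g xs) ≡ sumOver (λ x → F (g x)) xs
sumOver-map F g []       = refl
sumOver-map F g (x ∷ xs) = cong (F (g x) +_) (sumOver-map F g xs)

sumOver-tabulate : {X : Set} (n : ℕ) (f : Fin n → X) (F : X → ℕ) (G : ℕ → ℕ) →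
                   (∀ i → F (f i) ≡ G (toℕ i)) → sumOver F (tabulate f) ≡ sumBelow n G
sumOver-tabulate zero    f F G F≡G = refl
sumOver-tabulate (suc n) f F G F≡G =
  cong₂ _+_ (F≡G zero) (sumOver-tabulate n (λ i → f (suc i)) F (λ j → G (suc j)) (λ i → F≡G (suc i)))

module _ {n : ℕ} (G : SimpleGraph n) where

  degree≡sumBelow : (A : ℕ → ℕ → Bool) → (∀ u v → adj G u v ≡ A (toℕ u) (toℕ v)) →
                    ∀ v → degree G v ≡ ∑[ j < n ] 𝟙 (A (toℕ v) j)
  degree≡sumBelow A adj≡A v = trans (length-filter≡sumOver (λ u → T? (adj G v u)) (allFin n))
    (sumOver-tabulate n (λ u → u) (λ u → 𝟙 (adj G v u)) (λ j → 𝟙 (A (toℕ v) j))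
                      (λ u → cong 𝟙 (adj≡A v u)))

  h≡sumBelow : ∀ k (d : ℕ → ℕ) → (∀ v → degree G v ≡ d (toℕ v)) →
               h k G ≡ ∑[ i < n ] ∑[ j < n ] 𝟙 (does (i <? j) ∧ does (absDiff (d i) (d j) <? k))
  h≡sumBelow k d degree≡d = begin
    h k G                                           ≡⟨ length-filter≡sumOver close? (pairs n) ⟩
    sumOver (λ p → 𝟙 (does (close? p))) (pairs n)   ≡⟨ sumOver-filter ordered? (λ p → does (close? p)) grid ⟩
    sumOver F grid                                  ≡⟨ sumOver-concatMap F row (allFin n) ⟩
    sumOver (λ i → sumOver F (row i)) (allFin n)    ≡⟨ sumOver-tabulate n (λ i → i) _ _ sumOver-row ⟩
    ∑[ i < n ] ∑[ j < n ] 𝟙 (does (i <? j) ∧ does (absDiff (d i) (d j) <? k)) ∎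
    where
    open ≡-Reasoning
    close? : (p : Fin n × Fin n) → Dec (absDiff (degree G (proj₁ p)) (degree G (proj₂ p)) < k)
    close? p = absDiff (degree G (proj₁ p)) (degree G (proj₂ p)) <? k
    ordered? : (p : Fin n × Fin n) → Dec (toℕ (proj₁ p) < toℕ (proj₂ p))
    ordered? p = toℕ (proj₁ p) <? toℕ (proj₂ p)
    row : Fin n → List (Fin n × Fin n)
    row i = map (λ j → i , j) (allFin n)
    grid : List (Fin n × Fin n)
    grid = concatMap row (allFin n)
    F : Fin n × Fin n → ℕ
    F p = 𝟙 (does (ordered? p) ∧ does (close? p))
    sumOver-row : ∀ i → sumOver F (row i) ≡
                        ∑[ j < n ] 𝟙 (does (toℕ i <? j) ∧ does (absDiff (d (toℕ i)) (d j) <? k))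
    sumOver-row i = trans (sumOver-map F (λ j → i , j) (allFin n))
      (sumOver-tabulate n (λ j → j) _ _ (λ j → cong (λ δ → 𝟙 (does (toℕ i <? toℕ j) ∧ does (δ <? k)))
                                                  (cong₂ absDiff (degree≡d i) (degree≡d j))))

block : (m : ℕ) → (ℕ → ℕ) → ℕ → ℕ
block zero    sz j = 0
block (suc m) sz j with j <? sz 0
... | yes _ = 0
... | no  _ = suc (block m (λ a → sz (suc a)) (j ∸ sz 0))

block-head : ∀ m sz j → j < sz 0 → block (suc m) sz j ≡ 0
block-head m sz j j<s with j <? sz 0
... | yes _   = refl
... | no j≮s = contradiction j<s j≮s

block-tail : ∀ m sz j → block (suc m) sz (sz 0 + j) ≡ suc (block m (λ a → sz (suc a)) j)
block-tail m sz j with sz 0 + j <? sz 0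
... | yes s+j<s = contradiction s+j<s (m+n≮m (sz 0) j)
... | no  _     = cong (λ i → suc (block m (λ a → sz (suc a)) i)) (m+n∸m≡n (sz 0) j)

block-< : ∀ m sz j → j < sumBelow m sz → block m sz j < m
block-< (suc m) sz j j<N with j <? sz 0
... | yes _   = z<s
... | no j≮s = s<s (block-< m (λ a → sz (suc a)) (j ∸ sz 0)
  (subst (j ∸ sz 0 <_) (m+n∸m≡n (sz 0) _) (∸-monoˡ-< j<N (≮⇒≥ j≮s))))

count-by-block : ∀ m sz (q : ℕ → Bool) →
                 ∑[ j < sumBelow m sz ] 𝟙 (q (block m sz j)) ≡ ∑[ a < m ] (if q a then sz a else 0)
count-by-block zero    sz q = refl
count-by-block (suc m) sz q = begin
  ∑[ j < sz 0 + N ] 𝟙 (q (block (suc m) sz j))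
    ≡⟨ sumBelow-+ (sz 0) N _ ⟩
  ∑[ j < sz 0 ] 𝟙 (q (block (suc m) sz j)) + ∑[ j < N ] 𝟙 (q (block (suc m) sz (sz 0 + j)))
    ≡⟨ cong₂ _+_ (sumBelow-cong (sz 0) (λ j j<s → cong (λ a → 𝟙 (q a)) (block-head m sz j j<s)))
                 (sumBelow-cong N (λ j _ → cong (λ a → 𝟙 (q a)) (block-tail m sz j))) ⟩
  ∑[ _ < sz 0 ] 𝟙 (q 0) + ∑[ j < N ] 𝟙 (q (suc (block m sz′ j)))
    ≡⟨ cong₂ _+_ (sumBelow-𝟙-const (sz 0) (q 0)) (count-by-block m sz′ (λ a → q (suc a))) ⟩
  (if q 0 then sz 0 else 0) + ∑[ a < m ] (if q (suc a) then sz′ a else 0) ∎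
  where
  open ≡-Reasoning
  sz′ : ℕ → ℕ
  sz′ a = sz (suc a)
  N : ℕ
  N = sumBelow m sz′

sameBlockPairs : ℕ → (ℕ → ℕ) → ℕ
sameBlockPairs m sz = ∑[ i < N ] ∑[ j < N ] 𝟙 (does (i <? j) ∧ does (block m sz i ≟ block m sz j))
  where
  N : ℕ
  N = sumBelow m sz

sameBlockPairs≡sumBelow-C : ∀ m sz → sameBlockPairs m sz ≡ ∑[ a < m ] (sz a C 2)
sameBlockPairs≡sumBelow-C zero    sz = refl
sameBlockPairs≡sumBelow-C (suc m) sz = begin
  sumBelow (s + N) row
    ≡⟨ sumBelow-+ s N row ⟩
  sumBelow s row + ∑[ i < N ] row (s + i)
    ≡⟨ cong₂ _+_ (sumBelow-cong s head-row) (sumBelow-cong N tail-row) ⟩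
  ∑[ i < s ] (s ∸ suc i) + sameBlockPairs m sz′
    ≡⟨ cong₂ _+_ (sumBelow-∸ s) (sameBlockPairs≡sumBelow-C m sz′) ⟩
  s C 2 + ∑[ a < m ] (sz′ a C 2) ∎
  where
  open ≡-Reasoning
  s : ℕ
  s = sz 0
  sz′ : ℕ → ℕ
  sz′ a = sz (suc a)
  N : ℕ
  N = sumBelow m sz′
  B : ℕ → ℕ
  B = block (suc m) sz
  row : ℕ → ℕ
  row i = ∑[ j < s + N ] 𝟙 (does (i <? j) ∧ does (B i ≟ B j))
  head-row : ∀ i → i < s → row i ≡ s ∸ suc i
  head-row i i<s = begin
    row i
      ≡⟨ sumBelow-+ s N _ ⟩
    ∑[ j < s ] 𝟙 (does (i <? j) ∧ does (B i ≟ B j))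
      + ∑[ j < N ] 𝟙 (does (i <? s + j) ∧ does (B i ≟ B (s + j)))
      ≡⟨ cong₂ _+_
           (sumBelow-cong s (λ j j<s → cong (λ b → 𝟙 (does (i <? j) ∧ b))
             (cong₂ (λ x y → does (x ≟ y)) (block-head m sz i i<s) (block-head m sz j j<s))))
           (sumBelow-cong N (λ j _ → cong (λ b → 𝟙 (does (i <? s + j) ∧ b))
             (cong₂ (λ x y → does (x ≟ y)) (block-head m sz i i<s) (block-tail m sz j)))) ⟩
    ∑[ j < s ] 𝟙 (does (i <? j) ∧ true) + ∑[ j < N ] 𝟙 (does (i <? s + j) ∧ false)
      ≡⟨ cong₂ _+_ (sumBelow-cong s (λ j _ → cong 𝟙 (∧-identityʳ _)))
                   (trans (sumBelow-cong N (λ j _ → cong 𝟙 (∧-zeroʳ _))) (sumBelow-𝟙-const N false)) ⟩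
    ∑[ j < s ] 𝟙 (does (i <? j)) + 0
      ≡⟨ trans (+-identityʳ _) (count-< s i) ⟩
    s ∸ suc i ∎
  tail-row : ∀ i → i < N →
             row (s + i) ≡ ∑[ j < N ] 𝟙 (does (i <? j) ∧ does (block m sz′ i ≟ block m sz′ j))
  tail-row i _ = begin
    row (s + i)
      ≡⟨ sumBelow-+ s N _ ⟩
    ∑[ j < s ] 𝟙 (does (s + i <? j) ∧ does (B (s + i) ≟ B j))
      + ∑[ j < N ] 𝟙 (does (s + i <? s + j) ∧ does (B (s + i) ≟ B (s + j)))
      ≡⟨ cong₂ _+_
           (trans (sumBelow-cong s (λ j j<s → cong (λ b → 𝟙 (b ∧ does (B (s + i) ≟ B j)))
             (dec-false (s + i <? j) (λ s+i<j → m+n≮m s i (<-trans s+i<j j<s))))) (sumBelow-𝟙-const s false))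
           (sumBelow-cong N (λ j _ → cong 𝟙 (cong₂ _∧_ (+-cancelˡ-<? s i j)
             (cong₂ (λ x y → does (x ≟ y)) (block-tail m sz i) (block-tail m sz j))))) ⟩
    ∑[ j < N ] 𝟙 (does (i <? j) ∧ does (block m sz′ i ≟ block m sz′ j)) ∎

m+k≤n⇒absDiff≮k : ∀ {m n k} → m + k ≤ n → ¬ (absDiff m n < k)
m+k≤n⇒absDiff≮k {m} {n} {k} m+k≤n δ<k = <⇒≱ δ<k (+-cancelˡ-≤ m k _ (begin
  m + k           ≤⟨ m+k≤n ⟩
  n               ≤⟨ m≤n+∣m-n∣ n m ⟩
  m + ∣ n - m ∣   ≡⟨ cong (m +_) (∣-∣-comm n m) ⟩
  m + ∣ m - n ∣   ∎))
  where open ≤-Reasoning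

module ThresholdGraph (n m θ : ℕ) (sz : ℕ → ℕ) (sum-sz : sumBelow m sz ≡ n) where

  B : ℕ → ℕ
  B = block m sz

  adjacent : ℕ → ℕ → Bool
  adjacent x y = not (does (x ≟ y)) ∧ does (θ ≤? B x + B y)

  graph : SimpleGraph n
  graph = record
    { adj    = λ u v → adjacent (toℕ u) (toℕ v)
    ; symm   = λ u v → cong₂ (λ e t → not e ∧ does (θ ≤? t))
                             (does-≟-sym (toℕ u) (toℕ v)) (+-comm (B (toℕ u)) (B (toℕ v)))
    ; irrefl = λ v → cong (λ e → not e ∧ does (θ ≤? B (toℕ v) + B (toℕ v))) (does-≟-refl (toℕ v))
    }

  weight : ℕ → ℕ
  weight a = ∑[ t < m ] (if does (θ ≤? a + t) then sz t else 0)

  selfLoop : ℕ → ℕ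
  selfLoop a = 𝟙 (does (θ ≤? a + a))

  deg : ℕ → ℕ
  deg x = ∑[ j < n ] 𝟙 (adjacent x j)

  deg+selfLoop≡weight : ∀ x → x < n → deg x + selfLoop (B x) ≡ weight (B x)
  deg+selfLoop≡weight x x<n = begin
    deg x + selfLoop (B x)
      ≡⟨ count-≢-+-self n x (λ j → does (θ ≤? B x + B j)) x<n ⟩
    ∑[ j < n ] 𝟙 (does (θ ≤? B x + B j))
      ≡⟨ cong (λ N → ∑[ j < N ] 𝟙 (does (θ ≤? B x + B j))) sum-sz ⟨
    ∑[ j < sumBelow m sz ] 𝟙 (does (θ ≤? B x + B j))
      ≡⟨ count-by-block m sz (λ b → does (θ ≤? B x + b)) ⟩
    weight (B x) ∎
    where open ≡-Reasoning

  weight-gap : ∀ {a b} t → a ≤ b → t < m → a + t < θ → θ ≤ b + t → weight a + sz t ≤ weight b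
  weight-gap {a} {b} t a≤b t<m a+t<θ θ≤b+t = sumBelow-mono-gap m (sz t) t t<m
    (λ j _ → if-≤ (θ ≤? a + j) (θ ≤? b + j) (λ θ≤a+j → ≤-trans θ≤a+j (+-monoˡ-≤ j a≤b)))
    gap
    where
    gap : (if does (θ ≤? a + t) then sz t else 0) + sz t ≤ (if does (θ ≤? b + t) then sz t else 0)
    gap rewrite dec-false (θ ≤? a + t) (<⇒≱ a+t<θ) | dec-true (θ ≤? b + t) θ≤b+t = ≤-refl
    if-≤ : ∀ {X Y : Set} {s : ℕ} (x : Dec X) (y : Dec Y) → (X → Y) →
           (if does x then s else 0) ≤ (if does y then s else 0)
    if-≤ (yes _) (yes _) X→Y = ≤-refl
    if-≤ (yes X) (no ¬Y) X→Y = contradiction (X→Y X) ¬Y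
    if-≤ (no _)  _       X→Y = z≤n

  -- separated says (weight b ∸ selfLoop b) − (weight a ∸ selfLoop a) ≥ k, without truncated subtraction.
  module _ (k : ℕ) (0<k : 0 < k)
           (separated : ∀ a b → a < b → b < m → weight a + selfLoop b + k ≤ weight b + selfLoop a) where

    deg-gap : ∀ x y → x < n → y < n → B x < B y → deg x + k ≤ deg y
    deg-gap x y x<n y<n Bx<By = +-cancelʳ-≤ (la + lb) (deg x + k) (deg y) (begin
      deg x + k + (la + lb)     ≡⟨ solve 4 (λ d k′ l l′ → d :+ k′ :+ (l :+ l′) := d :+ l :+ l′ :+ k′)
                                           refl (deg x) k la lb ⟩
      deg x + la + lb + k       ≡⟨ cong (λ w → w + lb + k) (deg+selfLoop≡weight x x<n) ⟩
      weight (B x) + lb + k     ≤⟨ separated (B x) (B y) Bx<By (block-< m sz y (subst (y <_) (sym sum-sz) y<n)) ⟩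
      weight (B y) + la         ≡⟨ cong (_+ la) (deg+selfLoop≡weight y y<n) ⟨
      deg y + lb + la           ≡⟨ solve 3 (λ d l l′ → d :+ l′ :+ l := d :+ (l :+ l′)) refl (deg y) la lb ⟩
      deg y + (la + lb)         ∎)
      where
      open ≤-Reasoning
      la lb : ℕ
      la = selfLoop (B x)
      lb = selfLoop (B y)

    close⇔sameBlock : ∀ x y → x < n → y < n → does (absDiff (deg x) (deg y) <? k) ≡ does (B x ≟ B y)
    close⇔sameBlock x y x<n y<n with <-cmp (B x) (B y)
    ... | tri< Bx<By Bx≢By _ = trans (dec-false (_ <? k) (m+k≤n⇒absDiff≮k (deg-gap x y x<n y<n Bx<By)))
                                     (sym (dec-false (B x ≟ B y) Bx≢By))
    ... | tri> _ Bx≢By By<Bx = trans (dec-false (_ <? k) (λ δ<k → m+k≤n⇒absDiff≮k (deg-gap y x y<n x<n By<Bx)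
                                                                   (subst (_< k) (∣-∣-comm (deg x) (deg y)) δ<k)))
                                     (sym (dec-false (B x ≟ B y) Bx≢By))
    ... | tri≈ _ Bx≡By _     = trans (dec-true (_ <? k) (subst (_< k) (sym (m≡n⇒∣m-n∣≡0 deg≡)) 0<k))
                                     (sym (dec-true (B x ≟ B y) Bx≡By))
      where
      deg≡ : deg x ≡ deg y
      deg≡ = +-cancelʳ-≡ (selfLoop (B x)) (deg x) (deg y) (begin
        deg x + selfLoop (B x)  ≡⟨ deg+selfLoop≡weight x x<n ⟩
        weight (B x)            ≡⟨ cong weight Bx≡By ⟩
        weight (B y)            ≡⟨ deg+selfLoop≡weight y y<n ⟨
        deg y + selfLoop (B y)  ≡⟨ cong (λ b → deg y + selfLoop b) Bx≡By ⟨
        deg y + selfLoop (B x)  ∎)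
        where open ≡-Reasoning

    h≡sumBelow-C : h k graph ≡ ∑[ a < m ] (sz a C 2)
    h≡sumBelow-C = begin
      h k graph
        ≡⟨ h≡sumBelow graph k deg (degree≡sumBelow graph adjacent (λ _ _ → refl)) ⟩
      ∑[ i < n ] ∑[ j < n ] 𝟙 (does (i <? j) ∧ does (absDiff (deg i) (deg j) <? k))
        ≡⟨ sumBelow-cong n (λ i i<n → sumBelow-cong n (λ j j<n →
             cong (λ b → 𝟙 (does (i <? j) ∧ b)) (close⇔sameBlock i j i<n j<n))) ⟩
      ∑[ i < n ] ∑[ j < n ] 𝟙 (does (i <? j) ∧ does (B i ≟ B j))
        ≡⟨ cong (λ N → ∑[ i < N ] ∑[ j < N ] 𝟙 (does (i <? j) ∧ does (B i ≟ B j))) sum-sz ⟨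
      sameBlockPairs m sz
        ≡⟨ sameBlockPairs≡sumBelow-C m sz ⟩
      ∑[ a < m ] (sz a C 2) ∎
      where open ≡-Reasoning

module Construction (n k p : ℕ) (k[1+p]<n : k * suc p < n) where

  r : ℕ
  r = n ∸ k * suc p ∸ 1

  -- Block k + 1 must lie in [p + 1 − b, p − a] whenever 2a ≤ p < 2b, i.e. a ≤ ⌊p/2⌋ < b.
  centre : ℕ
  centre = ⌈ p /2⌉

  sizes : ℕ → ℕ
  sizes a = if does (a ≟ suc p) then r else (if does (a ≟ centre) then suc k else k)

  sizes-inner : ∀ a → a ≤ p → sizes a ≡ (if does (a ≟ centre) then suc k else k)
  sizes-inner a a≤p rewrite dec-false (a ≟ suc p) (<⇒≢ (s≤s a≤p)) = refl

  sizes-last : sizes (suc p) ≡ r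
  sizes-last rewrite does-≟-refl (suc p) = refl

  sumBelow-sizes : ∑[ a < suc (suc p) ] sizes a ≡ n
  sumBelow-sizes = begin
    ∑[ a < suc (suc p) ] sizes a      ≡⟨ sumBelow-suc (suc p) sizes ⟩
    ∑[ a < suc p ] sizes a + sizes (suc p)
      ≡⟨ cong₂ _+_ (trans (sumBelow-cong (suc p) (λ a a<1+p → sizes-inner a (≤-pred a<1+p)))
                          (sumBelow-if-≟ p centre (suc k) k (⌈n/2⌉≤n p)))
                   sizes-last ⟩
    p * k + suc k + r                 ≡⟨ solve 3 (λ P K R → P :* K :+ (con 1 :+ K) :+ R
                                                     := K :* (con 1 :+ P) :+ (con 1 :+ R)) refl p k r ⟩
    k * suc p + suc r                 ≡⟨ cong (k * suc p +_) (m+[n∸m]≡n (m<n⇒0<n∸m k[1+p]<n)) ⟩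
    k * suc p + (n ∸ k * suc p)       ≡⟨ m+[n∸m]≡n (<⇒≤ k[1+p]<n) ⟩
    n                                 ∎
    where open ≡-Reasoning

  sumBelow-sizes-C : ∑[ a < suc (suc p) ] (sizes a C 2) ≡ p * (k C 2) + suc k C 2 + r C 2
  sumBelow-sizes-C = begin
    ∑[ a < suc (suc p) ] (sizes a C 2)          ≡⟨ sumBelow-suc (suc p) (λ a → sizes a C 2) ⟩
    ∑[ a < suc p ] (sizes a C 2) + sizes (suc p) C 2
      ≡⟨ cong₂ _+_ (trans (sumBelow-cong (suc p) (λ a a<1+p →
                             trans (cong (_C 2) (sizes-inner a (≤-pred a<1+p))) (if-C (does (a ≟ centre)))))
                          (sumBelow-if-≟ p centre (suc k C 2) (k C 2) (⌈n/2⌉≤n p)))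
                   (cong (_C 2) sizes-last) ⟩
    p * (k C 2) + suc k C 2 + r C 2             ∎
    where
    open ≡-Reasoning
    if-C : ∀ b → (if b then suc k else k) C 2 ≡ (if b then suc k C 2 else k C 2)
    if-C true  = refl
    if-C false = refl

  open ThresholdGraph n (suc (suc p)) (suc p) sizes sumBelow-sizes public

  weight-gap-k : ∀ {a b} → a < b → b < suc (suc p) → weight a + k ≤ weight b
  weight-gap-k {a} {b} a<b b<2+p = ≤-trans (+-monoʳ-≤ (weight a) k≤size)
    (weight-gap t (<⇒≤ a<b) (s≤s (m≤n⇒m≤1+n (m∸n≤m p a))) (≤-reflexive (cong suc a+t≡p))
                (subst (_≤ b + t) (cong suc a+t≡p) (+-monoˡ-≤ t a<b)))
    where
    t : ℕ
    t = p ∸ a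
    a+t≡p : a + t ≡ p
    a+t≡p = m+[n∸m]≡n (≤-pred (<-≤-trans a<b (≤-pred b<2+p)))
    k≤size : k ≤ sizes t
    k≤size rewrite sizes-inner t (m∸n≤m p a) with does (t ≟ centre)
    ... | true  = n≤1+n k
    ... | false = ≤-refl

  weight-gap-suc-k : ∀ {a b} → a < b → a + a ≤ p → p < b + b → weight a + suc k ≤ weight b
  weight-gap-suc-k {a} {b} a<b a+a≤p p<b+b = subst (λ s → weight a + s ≤ weight b) size-centre
    (weight-gap centre (<⇒≤ a<b) (s≤s (m≤n⇒m≤1+n (⌈n/2⌉≤n p))) (s≤s a+centre≤p) θ≤b+centre)
    where
    halves : ⌊ p /2⌋ + centre ≡ p
    halves = ⌊n/2⌋+⌈n/2⌉≡n p
    a≤half : a ≤ ⌊ p /2⌋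
    a≤half = subst (_≤ ⌊ p /2⌋) (sym (n≡⌊n+n/2⌋ a)) (⌊n/2⌋-mono a+a≤p)
    half<b : ⌊ p /2⌋ < b
    half<b = subst (suc ⌊ p /2⌋ ≤_) (sym (n≡⌈n+n/2⌉ b)) (⌊n/2⌋-mono (s≤s p<b+b))
    a+centre≤p : a + centre ≤ p
    a+centre≤p = subst (a + centre ≤_) halves (+-monoˡ-≤ centre a≤half)
    θ≤b+centre : suc p ≤ b + centre
    θ≤b+centre = subst (_≤ b + centre) (cong suc halves) (+-monoˡ-≤ centre half<b)
    size-centre : sizes centre ≡ suc k
    size-centre rewrite sizes-inner centre (⌈n/2⌉≤n p) | does-≟-refl centre = refl

  separated : ∀ a b → a < b → b < suc (suc p) → weight a + selfLoop b + k ≤ weight b + selfLoop a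
  separated a b a<b b<2+p = by-loops (suc p ≤? a + a) (suc p ≤? b + b)
    where
    by-loops : (la : Dec (suc p ≤ a + a)) (lb : Dec (suc p ≤ b + b)) →
               weight a + 𝟙 (does lb) + k ≤ weight b + 𝟙 (does la)
    by-loops (yes _) (yes _) =
      subst₂ _≤_ (sym (trans (+-assoc (weight a) 1 k) (+-suc (weight a) k))) (+-comm 1 (weight b))
                 (s≤s (weight-gap-k a<b b<2+p))
    by-loops (no _) (no _) =
      subst₂ _≤_ (cong (_+ k) (sym (+-identityʳ (weight a)))) (sym (+-identityʳ (weight b)))
                 (weight-gap-k a<b b<2+p)
    by-loops (no a+a≱θ) (yes θ≤b+b) =
      subst₂ _≤_ (sym (+-assoc (weight a) 1 k)) (sym (+-identityʳ (weight b)))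
                 (weight-gap-suc-k a<b (≤-pred (≰⇒> a+a≱θ)) θ≤b+b)
    by-loops (yes θ≤a+a) (no b+b≱θ) =
      contradiction (≤-trans θ≤a+a (+-mono-≤ (<⇒≤ a<b) (<⇒≤ a<b))) b+b≱θ

ceilDiv-view : ∀ n k′ → suc k′ < n → ∃[ p ] ceilDiv n (suc k′) ≡ suc (suc p) × suc k′ * suc p < n
ceilDiv-view n k′ k<n = view ((n + k′) / suc k′) ((n + k′) % suc k′)
  (m≡m%n+[m/n]*n (n + k′) (suc k′)) (m%n<n (n + k′) (suc k′))
  where
  open ≤-Reasoning
  view : ∀ q ρ → n + k′ ≡ ρ + q * suc k′ → ρ < suc k′ → ∃[ p ] q ≡ suc (suc p) × suc k′ * suc p < n
  view zero ρ eq ρ<k = contradiction (begin-strict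
    n + k′       ≡⟨ eq ⟩
    ρ + 0        ≡⟨ +-identityʳ ρ ⟩
    ρ            <⟨ ρ<k ⟩
    suc k′       <⟨ k<n ⟩
    n            ≤⟨ m≤m+n n k′ ⟩
    n + k′       ∎) (<-irrefl refl)
  view (suc zero) ρ eq ρ<k = contradiction (begin-strict
    suc k′ + k′         <⟨ +-monoˡ-< k′ k<n ⟩
    n + k′              ≡⟨ eq ⟩
    ρ + (suc k′ + 0)    ≤⟨ +-monoˡ-≤ (suc k′ + 0) (≤-pred ρ<k) ⟩
    k′ + (suc k′ + 0)   ≡⟨ solve 1 (λ K → K :+ ((con 1 :+ K) :+ con 0) := (con 1 :+ K) :+ K) refl k′ ⟩
    suc k′ + k′         ∎) (<-irrefl refl)
  view (suc (suc p)) ρ eq ρ<k = p , refl , +-cancelʳ-≤ k′ _ _ (begin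
    suc (suc k′ * suc p) + k′   ≡⟨ solve 2 (λ K P → con 1 :+ (con 1 :+ K) :* (con 1 :+ P) :+ K
                                                   := (con 2 :+ P) :* (con 1 :+ K)) refl k′ p ⟩
    suc (suc p) * suc k′        ≤⟨ m≤n+m _ ρ ⟩
    ρ + suc (suc p) * suc k′    ≡⟨ eq ⟨
    n + k′                      ∎)

theorem1 : (n k : ℕ) → .{{_ : NonZero k}} → k < n →
    Σ (SimpleGraph n) (λ G → h k G ≡ f₀ n k)
    × (∀ (f : ℕ) → IsMinH n k f → f ≤ f₀ n k)
theorem1 n k@(suc k′) k<n with ceilDiv-view n k′ k<n
... | p , ceil≡2+p , k[1+p]<n = (graph , h≡f₀) , λ f (_ , f≤h) → subst (f ≤_) h≡f₀ (f≤h graph)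
  where
  open Construction n k p k[1+p]<n
  h≡f₀ : h k graph ≡ f₀ n k
  h≡f₀ = begin
    h k graph                                 ≡⟨ h≡sumBelow-C k z<s separated ⟩
    ∑[ a < suc (suc p) ] (sizes a C 2)        ≡⟨ sumBelow-sizes-C ⟩
    p * (k C 2) + suc k C 2 + r C 2           ≡⟨ cong (λ s → p * (k C 2) + s C 2 + r C 2) (+-comm 1 k) ⟩
    p * binom2 k + binom2 (k + 1) + binom2 r
      ≡⟨ cong (λ q → (q ∸ 2) * binom2 k + binom2 (k + 1) + binom2 (n ∸ k * (q ∸ 1) ∸ 1)) ceil≡2+p ⟨
    f₀ n k                                    ∎
    where open ≡-Reasoning
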